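{- Let $G$ be the Hermitian forms graph of diameter $d\ge2$ over $\mathrm{GF}(q^2)$, with eigenvalues $\theta_i=((-q)^{2d-i}-1)/(q+1)$, $i=0,\dots,d$. Then \[ \min_{1\le r\le d}\left\{\frac{1-w_r(\theta_2)}{r^2}\right\}=\frac{1-w_d(\theta_2)}{d^2}. \]
   Context: The Hermitian forms graph has as vertices the $d\times d$ Hermitian matrices over $\mathrm{GF}(q^2)$, two being adjacent iff their difference has rank $1$; it is distance-regular of diameter $d$ (classical parameters $(d,-q,-q-1,-(-q)^d-1)$), its distinct adjacency eigenvalues are $\theta_i=((-q)^{2d-i}-1)/(q+1)$, $0\le i\le d$, and its second largest eigenvalue is $\theta_2$. For a distance-regular graph with valency $k$ and intersection numbers $b_i,c_i$, $a_i=k-b_i-c_i$, the cosine sequence of an eigenvalue $\theta$ is defined by $w_0(\theta)=1$, $w_1(\theta)=\theta/k$, $c_iw_{i-1}(\theta)+a_iw_i(\theta)+b_iw_{i+1}(\theta)=\theta w_i(\theta)$ ($1\le i\le d-1$). -}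

module Defs where

open import Data.Nat as ℕ using (ℕ; zero; suc)
open import Data.Nat.Primality using (Prime)
open import Data.Integer as ℤ using (ℤ; +_; -[1+_])
open import Data.Rational as ℚ using (ℚ; 0ℚ; 1ℚ; _⊓_)
open import Data.Product using (∃₂; _×_)
open import Relation.Binary.PropositionalEquality using (_≡_)

IsPrimePower : ℕ → Set
IsPrimePower q = ∃₂ λ p m → Prime p × q ≡ p ℕ.^ suc m

⟦_⟧ : ℤ → ℚ
⟦ z ⟧ = z ℚ./ 1

-- Gaussian number [i] = 1 + b + ... + b^(i-1) for the base b = -q
gauss : ℕ → ℕ → ℤ
gauss q zero    = + 0
gauss q (suc i) = gauss q i ℤ.+ (ℤ.- (+ q)) ℤ.^ i

-- Classical parameters (d, b, α, β) = (d, -q, -q-1, -(-q)^d - 1)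
-- of the Hermitian forms graph of diameter d over GF(q^2).
αH : ℕ → ℤ
αH q = ℤ.- (+ q) ℤ.- + 1

βH : ℕ → ℕ → ℤ
βH q d = ℤ.- ((ℤ.- (+ q)) ℤ.^ d) ℤ.- + 1

-- intersection numbers from classical parameters (BCN Cor. 8.4.2):
-- b_i = ([d]-[i])(β - α[i]),  c_i = [i](1 + α[i-1]),  k = b_0, a_i = k - b_i - c_i
bH : ℕ → ℕ → ℕ → ℤ
bH q d i = (gauss q d ℤ.- gauss q i) ℤ.* (βH q d ℤ.- αH q ℤ.* gauss q i)

cH : ℕ → ℕ → ℕ → ℤ
cH q d zero    = + 0
cH q d (suc j) = gauss q (suc j) ℤ.* (+ 1 ℤ.+ αH q ℤ.* gauss q j)

kH : ℕ → ℕ → ℤ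
kH q d = bH q d 0

aH : ℕ → ℕ → ℕ → ℤ
aH q d i = kH q d ℤ.- bH q d i ℤ.- cH q d i

θH : ℕ → ℕ → ℕ → ℚ
θH q d i = ((ℤ.- (+ q)) ℤ.^ (2 ℕ.* d ℕ.∸ i) ℤ.- + 1) ℚ./ suc q

record IsCosineSeq (q d : ℕ) (θ : ℚ) (w : ℕ → ℚ) : Set where
  field
    w₀ : w 0 ≡ 1ℚ
    w₁ : ⟦ kH q d ⟧ ℚ.* w 1 ≡ θ
    rec : ∀ j → suc j ℕ.< d →
      ⟦ cH q d (suc j) ⟧ ℚ.* w j ℚ.+ ⟦ aH q d (suc j) ⟧ ℚ.* w (suc j)
        ℚ.+ ⟦ bH q d (suc j) ⟧ ℚ.* w (suc (suc j))
      ≡ θ ℚ.* w (suc j)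

-- 1 / r^2 (r ≥ 1; value at 0 irrelevant)
invSq : ℕ → ℚ
invSq zero    = 0ℚ
invSq (suc n) = + 1 ℚ./ (suc n ℕ.* suc n)

minFrom1 : (ℕ → ℚ) → ℕ → ℚ
minFrom1 f zero          = f 0
minFrom1 f (suc zero)    = f 1
minFrom1 f (suc (suc n)) = minFrom1 f (suc n) ⊓ f (suc (suc n))

-- Write b = −q and x = 1 − b = q + 1.  Multiplied by x the intersection numbers become integers,
-- x·cᵢ = (1 − bⁱ) bⁱ⁻¹ and x·bᵢ = b²ᵈ − b²ⁱ, and x·θ₂ = b²ᵈ⁻² − 1.  With y_r = b^(2d−1−r) and
-- Y(t) = t² − (b + 1) t, the integers z_r = y₀ − y₁ + 1 + Y(y_r) satisfy the scaled recurrence and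
-- the scaled initial conditions; as bᵢ ≠ 0 for i < d the recurrence determines the cosine sequence,
-- so w_r = z_r / z₀ with z₀ > 0, and z₀ (1 − w_r) = Y(y₀) − Y(y_r).  Since |y_r| = q^(2d−1−r) and
-- |t|² − (q − 1)|t| ≤ Y(t) ≤ |t|² + (q − 1)|t|, the inequality r² (1 − w_d) ≤ d² (1 − w_r) for r < d
-- follows from d² ≤ (d² − r²)(r + 1) ≤ (d² − r²) qʳ.
module Submission where

open import Defs
open import Data.Nat as ℕ using (ℕ; zero; suc; s≤s; z≤n)
import Data.Nat.Properties as ℕ
open import Data.Nat.Primality using (prime⇒nonTrivial)
open import Data.Nat.Tactic.RingSolver using () renaming (solve-∀ to ℕ-solve-∀)
open import Data.Integer as ℤ using (ℤ; +_; -[1+_])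
import Data.Integer.Properties as ℤ
open import Data.Integer.Tactic.RingSolver using (solve-∀)
open import Data.Rational as ℚ using (ℚ; 0ℚ; 1ℚ)
import Data.Rational.Properties as ℚ
open import Data.Rational.Solver using (module +-*-Solver)
open +-*-Solver using (solve; con; _:+_; _:*_; _:-_; _:=_)
open import Data.Rational.Unnormalised as ℚᵘ using (mkℚᵘ; *≡*; *≤*)
import Data.Rational.Unnormalised.Properties as ℚᵘ
open import Algebra.Properties.Group ℚ.+-0-group using (∙-cancelˡ)
open import Data.Product using (_×_; _,_; proj₁; proj₂)
open import Data.Sum using (inj₁; inj₂)
open import Relation.Binary.PropositionalEquality

-- The embedding ℤ → ℚ

toℚᵘ-⟦⟧ : ∀ i → ℚ.toℚᵘ ⟦ i ⟧ ℚᵘ.≃ mkℚᵘ i 0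
toℚᵘ-⟦⟧ i = ℚ.toℚᵘ-fromℚᵘ (mkℚᵘ i 0)

toℚᵘ≃⇒≡⟦⟧ : ∀ {p} i → ℚ.toℚᵘ p ℚᵘ.≃ mkℚᵘ i 0 → p ≡ ⟦ i ⟧
toℚᵘ≃⇒≡⟦⟧ i eq = ℚ.toℚᵘ-injective (ℚᵘ.≃-trans eq (ℚᵘ.≃-sym (toℚᵘ-⟦⟧ i)))

⟦⟧-homo-+ : ∀ i j → ⟦ i ℤ.+ j ⟧ ≡ ⟦ i ⟧ ℚ.+ ⟦ j ⟧
⟦⟧-homo-+ i j = sym (toℚᵘ≃⇒≡⟦⟧ (i ℤ.+ j) (ℚᵘ.≃-trans (ℚ.toℚᵘ-homo-+ ⟦ i ⟧ ⟦ j ⟧)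
  (ℚᵘ.≃-trans (ℚᵘ.+-cong (toℚᵘ-⟦⟧ i) (toℚᵘ-⟦⟧ j)) (*≡* (cross-multiplied i j)))))
  where
  cross-multiplied : ∀ i j → (i ℤ.* + 1 ℤ.+ j ℤ.* + 1) ℤ.* + 1 ≡ (i ℤ.+ j) ℤ.* (+ 1 ℤ.* + 1)
  cross-multiplied = solve-∀

⟦⟧-homo-* : ∀ i j → ⟦ i ℤ.* j ⟧ ≡ ⟦ i ⟧ ℚ.* ⟦ j ⟧
⟦⟧-homo-* i j = sym (toℚᵘ≃⇒≡⟦⟧ (i ℤ.* j) (ℚᵘ.≃-trans (ℚ.toℚᵘ-homo-* ⟦ i ⟧ ⟦ j ⟧)
  (ℚᵘ.*-cong (toℚᵘ-⟦⟧ i) (toℚᵘ-⟦⟧ j))))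

⟦⟧-homo-‿- : ∀ i → ⟦ ℤ.- i ⟧ ≡ ℚ.- ⟦ i ⟧
⟦⟧-homo-‿- i = sym (toℚᵘ≃⇒≡⟦⟧ (ℤ.- i) (ℚᵘ.≃-trans (ℚ.toℚᵘ-homo‿- ⟦ i ⟧) (ℚᵘ.-‿cong (toℚᵘ-⟦⟧ i))))

⟦⟧-homo-− : ∀ i j → ⟦ i ℤ.- j ⟧ ≡ ⟦ i ⟧ ℚ.- ⟦ j ⟧
⟦⟧-homo-− i j = trans (⟦⟧-homo-+ i (ℤ.- j)) (cong (⟦ i ⟧ ℚ.+_) (⟦⟧-homo-‿- j))

⟦⟧-homo-Σ₃ : ∀ c₀ u₀ c₁ u₁ c₂ u₂ →
  ⟦ c₀ ℤ.* u₀ ℤ.+ c₁ ℤ.* u₁ ℤ.+ c₂ ℤ.* u₂ ⟧ ≡ ⟦ c₀ ⟧ ℚ.* ⟦ u₀ ⟧ ℚ.+ ⟦ c₁ ⟧ ℚ.* ⟦ u₁ ⟧ ℚ.+ ⟦ c₂ ⟧ ℚ.* ⟦ u₂ ⟧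
⟦⟧-homo-Σ₃ c₀ u₀ c₁ u₁ c₂ u₂ = begin
  ⟦ c₀ ℤ.* u₀ ℤ.+ c₁ ℤ.* u₁ ℤ.+ c₂ ℤ.* u₂ ⟧
    ≡⟨ ⟦⟧-homo-+ (c₀ ℤ.* u₀ ℤ.+ c₁ ℤ.* u₁) (c₂ ℤ.* u₂) ⟩
  ⟦ c₀ ℤ.* u₀ ℤ.+ c₁ ℤ.* u₁ ⟧ ℚ.+ ⟦ c₂ ℤ.* u₂ ⟧
    ≡⟨ cong₂ ℚ._+_ (⟦⟧-homo-+ (c₀ ℤ.* u₀) (c₁ ℤ.* u₁)) (⟦⟧-homo-* c₂ u₂) ⟩
  ⟦ c₀ ℤ.* u₀ ⟧ ℚ.+ ⟦ c₁ ℤ.* u₁ ⟧ ℚ.+ ⟦ c₂ ⟧ ℚ.* ⟦ u₂ ⟧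
    ≡⟨ cong₂ (λ s t → s ℚ.+ t ℚ.+ ⟦ c₂ ⟧ ℚ.* ⟦ u₂ ⟧) (⟦⟧-homo-* c₀ u₀) (⟦⟧-homo-* c₁ u₁) ⟩
  ⟦ c₀ ⟧ ℚ.* ⟦ u₀ ⟧ ℚ.+ ⟦ c₁ ⟧ ℚ.* ⟦ u₁ ⟧ ℚ.+ ⟦ c₂ ⟧ ℚ.* ⟦ u₂ ⟧ ∎
  where open ≡-Reasoning

⟦⟧-injective : ∀ {i j} → ⟦ i ⟧ ≡ ⟦ j ⟧ → i ≡ j
⟦⟧-injective {i} {j} eq with ℚᵘ.≃-trans (ℚᵘ.≃-sym (toℚᵘ-⟦⟧ i)) (ℚᵘ.≃-trans (ℚ.toℚᵘ-cong eq) (toℚᵘ-⟦⟧ j))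
... | *≡* i*1≡j*1 = ℤ.*-cancelʳ-≡ i j (+ 1) i*1≡j*1

⟦⟧-mono-≤ : ∀ {i j} → i ℤ.≤ j → ⟦ i ⟧ ℚ.≤ ⟦ j ⟧
⟦⟧-mono-≤ {i} {j} i≤j = ℚ.toℚᵘ-cancel-≤
  (ℚᵘ.≤-respʳ-≃ (ℚᵘ.≃-sym (toℚᵘ-⟦⟧ j)) (ℚᵘ.≤-respˡ-≃ (ℚᵘ.≃-sym (toℚᵘ-⟦⟧ i))
    (*≤* (ℤ.*-monoʳ-≤-nonNeg (+ 1) i≤j))))

⟦⟧-pos : ∀ i .{{_ : ℤ.Positive i}} → ℚ.Positive ⟦ i ⟧
⟦⟧-pos (+ suc n) = ℚ.normalize-pos (suc n) 1

⟦⟧-*-/ : ∀ n .{{_ : ℕ.NonZero n}} i → ⟦ + n ⟧ ℚ.* (i ℚ./ n) ≡ ⟦ i ⟧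
⟦⟧-*-/ n@(suc m) i = toℚᵘ≃⇒≡⟦⟧ i (ℚᵘ.≃-trans (ℚ.toℚᵘ-homo-* ⟦ + n ⟧ (i ℚ./ n))
  (ℚᵘ.≃-trans (ℚᵘ.*-cong (toℚᵘ-⟦⟧ (+ n)) (ℚ.toℚᵘ-fromℚᵘ (mkℚᵘ i m))) (*≡* (cross-multiplied (+ n) i))))
  where
  cross-multiplied : ∀ n i → (n ℤ.* i) ℤ.* + 1 ≡ i ℤ.* (+ 1 ℤ.* n)
  cross-multiplied = solve-∀

-- Three-term recurrences over ℚ

module _ where
  open import Data.Rational using (_+_; _*_; _≤_)

  *-cancelˡ-≢0 : ∀ p {u v} → p ≢ 0ℚ → p * u ≡ p * v → u ≡ v
  *-cancelˡ-≢0 p {u} {v} p≢0 eq = begin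
    u                ≡⟨ ℚ.*-identityˡ u ⟨
    1ℚ * u           ≡⟨ cong (_* u) (ℚ.*-inverseˡ p) ⟨
    (1/p * p) * u    ≡⟨ ℚ.*-assoc 1/p p u ⟩
    1/p * (p * u)    ≡⟨ cong (1/p *_) eq ⟩
    1/p * (p * v)    ≡⟨ ℚ.*-assoc 1/p p v ⟨
    (1/p * p) * v    ≡⟨ cong (_* v) (ℚ.*-inverseˡ p) ⟩
    1ℚ * v           ≡⟨ ℚ.*-identityˡ v ⟩
    v                ∎
    where
    open ≡-Reasoning
    instance _ = ℚ.≢-nonZero p≢0
    1/p = ℚ.1/ p

  ThreeTermRecurrence : (c a b : ℕ → ℚ) (θ : ℚ) (d : ℕ) (w : ℕ → ℚ) → Set
  ThreeTermRecurrence c a b θ d w = ∀ j → suc j ℕ.< d →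
    c (suc j) * w j + a (suc j) * w (suc j) + b (suc j) * w (suc (suc j)) ≡ θ * w (suc j)

  module _ {c a b : ℕ → ℚ} {θ : ℚ} {d : ℕ} where

    ThreeTermRecurrence-scale : ∀ {c′ a′ b′ θ′ w} s t →
      (∀ i → c′ i ≡ s * c i) → (∀ i → a′ i ≡ s * a i) → (∀ i → b′ i ≡ s * b i) → θ′ ≡ s * θ →
      ThreeTermRecurrence c a b θ d w → ThreeTermRecurrence c′ a′ b′ θ′ d (λ i → t * w i)
    ThreeTermRecurrence-scale {c′} {a′} {b′} {θ′} {w} s t c′≡ a′≡ b′≡ θ′≡ rec j j<d = begin
      c′ i * (t * w j) + a′ i * (t * w i) + b′ i * (t * w (suc i))
        ≡⟨ cong₂ _+_ (cong₂ _+_ (cong (_* (t * w j)) (c′≡ i)) (cong (_* (t * w i)) (a′≡ i)))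
                     (cong (_* (t * w (suc i))) (b′≡ i)) ⟩
      s * c i * (t * w j) + s * a i * (t * w i) + s * b i * (t * w (suc i))
        ≡⟨ factor s t (c i) (a i) (b i) (w j) (w i) (w (suc i)) ⟩
      s * t * (c i * w j + a i * w i + b i * w (suc i))
        ≡⟨ cong (s * t *_) (rec j j<d) ⟩
      s * t * (θ * w i)
        ≡⟨ regroup s t θ (w i) ⟩
      s * θ * (t * w i)
        ≡⟨ cong (_* (t * w i)) θ′≡ ⟨
      θ′ * (t * w i) ∎
      where
      open ≡-Reasoning
      i = suc j
      factor : ∀ s t c a b u v w → s * c * (t * u) + s * a * (t * v) + s * b * (t * w)
                                 ≡ s * t * (c * u + a * v + b * w)
      factor = solve 8 (λ s t c a b u v w → s :* c :* (t :* u) :+ s :* a :* (t :* v) :+ s :* b :* (t :* w)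
                                         := s :* t :* (c :* u :+ a :* v :+ b :* w)) refl
      regroup : ∀ s t θ u → s * t * (θ * u) ≡ s * θ * (t * u)
      regroup = solve 4 (λ s t θ u → s :* t :* (θ :* u) := s :* θ :* (t :* u)) refl

    ThreeTermRecurrence-unique : ∀ {w w′} → (∀ j → suc j ℕ.< d → b (suc j) ≢ 0ℚ) →
      ThreeTermRecurrence c a b θ d w → ThreeTermRecurrence c a b θ d w′ →
      w 0 ≡ w′ 0 → w 1 ≡ w′ 1 → ∀ r → r ℕ.≤ d → w r ≡ w′ r
    ThreeTermRecurrence-unique {w} {w′} b≢0 rec rec′ w₀ w₁ = agree
      where
      next : ∀ j → suc j ℕ.< d → w j ≡ w′ j → w (suc j) ≡ w′ (suc j) → w (suc (suc j)) ≡ w′ (suc (suc j))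
      next j j<d eq₀ eq₁ = *-cancelˡ-≢0 (b i) (b≢0 j j<d) (∙-cancelˡ (c i * w j + a i * w i) _ _ (begin
        c i * w j + a i * w i + b i * w (suc i)     ≡⟨ rec j j<d ⟩
        θ * w i                                     ≡⟨ cong (θ *_) eq₁ ⟩
        θ * w′ i                                    ≡⟨ rec′ j j<d ⟨
        c i * w′ j + a i * w′ i + b i * w′ (suc i)  ≡⟨ cong₂ (λ u v → c i * u + a i * v + b i * w′ (suc i)) eq₀ eq₁ ⟨
        c i * w j + a i * w i + b i * w′ (suc i)    ∎))
        where
        open ≡-Reasoning
        i = suc j

      agree-pair : ∀ j → suc j ℕ.≤ d → w j ≡ w′ j × w (suc j) ≡ w′ (suc j)
      agree-pair zero    _   = w₀ , w₁
      agree-pair (suc j) j<d = let eq₀ , eq₁ = agree-pair j (ℕ.<⇒≤ j<d) in eq₁ , next j j<d eq₀ eq₁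

      agree : ∀ r → r ℕ.≤ d → w r ≡ w′ r
      agree zero    _   = w₀
      agree (suc r) r<d = proj₂ (agree-pair r r<d)

  minFrom1-glb : ∀ f n {m} → (∀ r → 1 ℕ.≤ r → r ℕ.≤ suc n → m ≤ f r) → m ≤ minFrom1 f (suc n)
  minFrom1-glb f zero    m≤f = m≤f 1 ℕ.≤-refl ℕ.≤-refl
  minFrom1-glb f (suc n) m≤f = ℚ.⊓-glb (minFrom1-glb f n (λ r 1≤r r≤n → m≤f r 1≤r (ℕ.m≤n⇒m≤1+n r≤n)))
                                       (m≤f (suc (suc n)) (s≤s z≤n) ℕ.≤-refl)

  minFrom1-attained : ∀ f n → (∀ r → 1 ℕ.≤ r → r ℕ.≤ suc n → f (suc n) ≤ f r) → minFrom1 f (suc n) ≡ f (suc n)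
  minFrom1-attained f zero    _    = refl
  minFrom1-attained f (suc n) fn≤f = ℚ.p≥q⇒p⊓q≡q
    (minFrom1-glb f n (λ r 1≤r r≤n → fn≤f r 1≤r (ℕ.m≤n⇒m≤1+n r≤n)))

  invSq-inverse : ∀ {n} → 1 ℕ.≤ n → ⟦ + (n ℕ.* n) ⟧ * invSq n ≡ 1ℚ
  invSq-inverse {suc m} _ = ⟦⟧-*-/ (suc m ℕ.* suc m) (+ 1)

  invSq-cross-≤ : ∀ n .{{_ : ℚ.Positive n}} u v {r d} → 1 ℕ.≤ r → 1 ℕ.≤ d →
    ⟦ + (r ℕ.* r) ⟧ * (n * u) ≤ ⟦ + (d ℕ.* d) ⟧ * (n * v) → u * invSq d ≤ v * invSq r
  invSq-cross-≤ n u v {r@(suc _)} {d@(suc _)} 1≤r 1≤d cross = ℚ.*-cancelˡ-≤-pos Z (begin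
    Z * (u * invSq d)               ≡⟨ shuffle n D R u (invSq d) ⟩
    R * (n * u) * (D * invSq d)     ≡⟨ cong (R * (n * u) *_) (invSq-inverse 1≤d) ⟩
    R * (n * u) * 1ℚ                ≡⟨ ℚ.*-identityʳ (R * (n * u)) ⟩
    R * (n * u)                     ≤⟨ cross ⟩
    D * (n * v)                     ≡⟨ ℚ.*-identityʳ (D * (n * v)) ⟨
    D * (n * v) * 1ℚ                ≡⟨ cong (D * (n * v) *_) (invSq-inverse 1≤r) ⟨
    D * (n * v) * (R * invSq r)     ≡⟨ shuffle′ n D R v (invSq r) ⟩
    Z * (v * invSq r)               ∎)
    where
    open ℚ.≤-Reasoning
    D = ⟦ + (d ℕ.* d) ⟧
    R = ⟦ + (r ℕ.* r) ⟧
    Z = n * D * R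
    instance
      _ = ⟦⟧-pos (+ (d ℕ.* d))
      _ = ⟦⟧-pos (+ (r ℕ.* r))
      _ = ℚ.pos*pos⇒pos n D
      _ = ℚ.pos*pos⇒pos (n * D) R
    shuffle : ∀ n D R u i → n * D * R * (u * i) ≡ R * (n * u) * (D * i)
    shuffle = solve 5 (λ n D R u i → n :* D :* R :* (u :* i) := R :* (n :* u) :* (D :* i)) refl
    shuffle′ : ∀ n D R v i → D * (n * v) * (R * i) ≡ n * D * R * (v * i)
    shuffle′ = solve 5 (λ n D R v i → D :* (n :* v) :* (R :* i) := n :* D :* R :* (v :* i)) refl

module _ where
  open import Data.Nat using (_+_; _*_; _^_; _∸_; _≤_; _<_)

  m≤m^n : ∀ m {n} → 1 ≤ n → m ≤ m ^ n
  m≤m^n zero        _   = z≤n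
  m≤m^n (suc k) {n} 1≤n = subst (_≤ suc k ^ n) (ℕ.^-identityʳ (suc k)) (ℕ.^-monoʳ-≤ (suc k) 1≤n)

  n<m^n : ∀ {m} n → 1 < m → n < m ^ n
  n<m^n     zero    _   = s≤s z≤n
  n<m^n {m} (suc n) 1<m = begin-strict
    suc n          <⟨ s≤s (n<m^n n 1<m) ⟩
    1 + m ^ n      ≤⟨ ℕ.+-monoˡ-≤ (m ^ n) (ℕ.m^n>0 m n) ⟩
    m ^ n + m ^ n  ≡⟨ cong (_+_ (m ^ n)) (ℕ.+-identityʳ (m ^ n)) ⟨
    2 * m ^ n      ≤⟨ ℕ.*-monoˡ-≤ (m ^ n) 1<m ⟩
    m ^ suc n      ∎
    where
    open ℕ.≤-Reasoning
    instance _ = ℕ.>-nonZero (ℕ.<-trans (s≤s z≤n) 1<m)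

  2*d∸2 : ∀ d → 2 * d ∸ 2 ≡ ℕ.pred d + ℕ.pred d
  2*d∸2 zero    = refl
  2*d∸2 (suc e) = cong (_∸ 2) (double e)
    where
    double : ∀ e → 2 * suc e ≡ 2 + (e + e)
    double = ℕ-solve-∀

  prime-power>1 : ∀ {q} → IsPrimePower q → 1 < q
  prime-power>1 (p , m , p-prime , refl) =
    ℕ.<-≤-trans (ℕ.nonTrivial⇒n>1 p {{prime⇒nonTrivial p-prime}}) (m≤m^n p {suc m} (s≤s z≤n))

  d²+r²P≤d²P : ∀ {r d P} → r < d → suc r ≤ P → d * d + r * r * P ≤ d * d * P
  d²+r²P≤d²P {r} {d} r<d r<P with ℕ.m≤n⇒∃[o]m+o≡n r<P
  ... | e , refl = begin
    d * d + r * r * (suc r + e)          ≡⟨ expand d r e ⟩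
    d * d + r * (r * suc r) + r * r * e  ≤⟨ ℕ.+-mono-≤ (ℕ.+-monoʳ-≤ (d * d) (ℕ.*-monoʳ-≤ r (ℕ.*-mono-≤ r≤d r<d)))
                                                      (ℕ.*-monoˡ-≤ e (ℕ.*-mono-≤ r≤d r≤d)) ⟩
    d * d + r * (d * d) + d * d * e      ≡⟨ collect d r e ⟩
    d * d * (suc r + e)                  ∎
    where
    open ℕ.≤-Reasoning
    r≤d = ℕ.<⇒≤ r<d
    expand : ∀ d r e → d * d + r * r * (suc r + e) ≡ d * d + r * (r * suc r) + r * r * e
    expand = ℕ-solve-∀
    collect : ∀ d r e → d * d + r * (d * d) + d * d * e ≡ d * d * (suc r + e)
    collect = ℕ-solve-∀

  gap-estimate : ∀ {r d A P c H} → r < d → suc r ≤ P → suc c ≤ P → 2 ≤ A → c + H ≡ P * A →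
    d * d * (A * A + c * A) + r * r * (P * A * H) ≤ d * d * (P * A * H)
  gap-estimate {r} {d} {A} {P} {c} {H} r<d r<P q≤P 2≤A c+H≡PA = begin
    d * d * (A * A + c * A) + r * r * (P * A * H)  ≡⟨ regroup d r A P c H ⟩
    d * d * (A * (A + c)) + r * r * P * (A * H)    ≤⟨ ℕ.+-monoˡ-≤ (r * r * P * (A * H))
                                                        (ℕ.*-monoʳ-≤ (d * d) (ℕ.*-monoʳ-≤ A A+c≤H)) ⟩
    d * d * (A * H) + r * r * P * (A * H)          ≡⟨ ℕ.*-distribʳ-+ (A * H) (d * d) (r * r * P) ⟨
    (d * d + r * r * P) * (A * H)                  ≤⟨ ℕ.*-monoˡ-≤ (A * H) (d²+r²P≤d²P r<d r<P) ⟩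
    d * d * P * (A * H)                            ≡⟨ reassoc d P A H ⟩
    d * d * (P * A * H)                            ∎
    where
    open ℕ.≤-Reasoning
    double : ∀ c A → c + (A + c) ≡ A + c * 2
    double = ℕ-solve-∀
    distribute : ∀ c A → A + c * A ≡ A * suc c
    distribute = ℕ-solve-∀
    A+c≤H : A + c ≤ H
    A+c≤H = ℕ.+-cancelˡ-≤ c (A + c) H (begin
      c + (A + c)  ≡⟨ double c A ⟩
      A + c * 2    ≤⟨ ℕ.+-monoʳ-≤ A (ℕ.*-monoʳ-≤ c 2≤A) ⟩
      A + c * A    ≡⟨ distribute c A ⟩
      A * suc c    ≤⟨ ℕ.*-monoʳ-≤ A q≤P ⟩
      A * P        ≡⟨ trans (ℕ.*-comm A P) (sym c+H≡PA) ⟩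
      c + H        ∎)
    regroup : ∀ d r A P c H → d * d * (A * A + c * A) + r * r * (P * A * H)
                            ≡ d * d * (A * (A + c)) + r * r * P * (A * H)
    regroup = ℕ-solve-∀
    reassoc : ∀ d P A H → d * d * P * (A * H) ≡ d * d * (P * A * H)
    reassoc = ℕ-solve-∀

module _ where
  open import Data.Integer using (_+_; _-_; -_; _*_; _^_; _≤_; ∣_∣)

  ^-∸ : ∀ (a : ℤ) k {m n} → m ℕ.+ k ℕ.≤ n → a ^ (n ℕ.∸ m) ≡ a ^ k * a ^ (n ℕ.∸ (m ℕ.+ k))
  ^-∸ a k {m} {n} m+k≤n = trans (cong (a ^_) n∸m≡k+rest) (ℤ.^-distribˡ-+-* a k (n ℕ.∸ (m ℕ.+ k)))
    where
    k≤n∸m : k ℕ.≤ n ℕ.∸ m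
    k≤n∸m = subst (ℕ._≤ n ℕ.∸ m) (ℕ.m+n∸m≡n m k) (ℕ.∸-monoˡ-≤ m m+k≤n)
    n∸m≡k+rest : n ℕ.∸ m ≡ k ℕ.+ (n ℕ.∸ (m ℕ.+ k))
    n∸m≡k+rest = trans (sym (ℕ.m+[n∸m]≡n k≤n∸m)) (cong (k ℕ.+_) (ℕ.∸-+-assoc n m k))

  ∣i^n∣≡∣i∣^n : ∀ i n → ∣ i ^ n ∣ ≡ ∣ i ∣ ℕ.^ n
  ∣i^n∣≡∣i∣^n i zero    = refl
  ∣i^n∣≡∣i∣^n i (suc n) = trans (ℤ.abs-* i (i ^ n)) (cong (∣ i ∣ ℕ.*_) (∣i^n∣≡∣i∣^n i n))

  i*i≡∣i∣*∣i∣ : ∀ i → i * i ≡ + (∣ i ∣ ℕ.* ∣ i ∣)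
  i*i≡∣i∣*∣i∣ (+ n)    = sym (ℤ.pos-* n n)
  i*i≡∣i∣*∣i∣ -[1+ n ] = refl

  i≤∣i∣ : ∀ i → i ≤ + ∣ i ∣
  i≤∣i∣ (+ n)    = ℤ.≤-refl
  i≤∣i∣ -[1+ n ] = ℤ.-≤+

  -∣i∣≤i : ∀ i → - + ∣ i ∣ ≤ i
  -∣i∣≤i (+ n)    = ℤ.neg-≤-pos
  -∣i∣≤i -[1+ n ] = ℤ.≤-refl

  weighted-difference-≤ : ∀ {U V W : ℤ} {L M r d : ℕ} → r ℕ.≤ d → + L ≤ U → V ≤ + M → + 0 ≤ W →
    d ℕ.* d ℕ.* M ℕ.+ r ℕ.* r ℕ.* L ℕ.≤ d ℕ.* d ℕ.* L →
    + (r ℕ.* r) * (U - W) ≤ + (d ℕ.* d) * (U - V)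
  weighted-difference-≤ {U} {V} {W} {L} {M} {r} {d} r≤d L≤U V≤M 0≤W weighted = begin
    + rr * (U - W)                           ≤⟨ ℤ.*-monoˡ-≤-nonNeg (+ rr) (ℤ.i≤j⇒i-k≤j W {{ℤ.nonNegative 0≤W}} ℤ.≤-refl) ⟩
    + rr * U                                 ≡⟨ ℤ.+-identityʳ (+ rr * U) ⟨
    + rr * U + + 0                           ≤⟨ ℤ.+-monoʳ-≤ (+ rr * U) (ℤ.i≤j⇒0≤j-i dd*V≤e*U) ⟩
    + rr * U + (+ e * U - + dd * V)          ≡⟨ cong (λ D → + rr * U + (+ e * U - D * V)) (cong +_ rr+e≡dd) ⟨
    + rr * U + (+ e * U - (+ rr + + e) * V)  ≡⟨ collect (+ rr) (+ e) U V ⟩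
    (+ rr + + e) * (U - V)                   ≡⟨ cong (λ D → D * (U - V)) (cong +_ rr+e≡dd) ⟩
    + dd * (U - V)                           ∎
    where
    open ℤ.≤-Reasoning
    rr = r ℕ.* r
    dd = d ℕ.* d
    e = proj₁ (ℕ.m≤n⇒∃[o]m+o≡n (ℕ.*-mono-≤ r≤d r≤d))
    rr+e≡dd : rr ℕ.+ e ≡ dd
    rr+e≡dd = proj₂ (ℕ.m≤n⇒∃[o]m+o≡n (ℕ.*-mono-≤ r≤d r≤d))
    dd*M≤e*L : dd ℕ.* M ℕ.≤ e ℕ.* L
    dd*M≤e*L = ℕ.+-cancelʳ-≤ (rr ℕ.* L) (dd ℕ.* M) (e ℕ.* L)
      (subst (dd ℕ.* M ℕ.+ rr ℕ.* L ℕ.≤_)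
        (trans (cong (ℕ._* L) (sym rr+e≡dd)) (trans (ℕ.*-distribʳ-+ L rr e) (ℕ.+-comm (rr ℕ.* L) (e ℕ.* L))))
        weighted)
    dd*V≤e*U : + dd * V ≤ + e * U
    dd*V≤e*U = begin
      + dd * V        ≤⟨ ℤ.*-monoˡ-≤-nonNeg (+ dd) V≤M ⟩
      + dd * + M      ≡⟨ ℤ.pos-* dd M ⟨
      + (dd ℕ.* M)    ≤⟨ ℤ.+≤+ dd*M≤e*L ⟩
      + (e ℕ.* L)     ≡⟨ ℤ.pos-* e L ⟩
      + e * + L       ≤⟨ ℤ.*-monoˡ-≤-nonNeg (+ e) L≤U ⟩
      + e * U         ∎
    collect : ∀ r e U V → r * U + (e * U - (r + e) * V) ≡ (r + e) * (U - V)
    collect = solve-∀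

-- The Hermitian forms graph

module HermitianFormsGraph (q d : ℕ) where
  open import Data.Integer using (_+_; _-_; -_; _*_; _^_; ∣_∣)

  b : ℤ
  b = - + q

  x : ℤ
  x = + 1 - b

  y : ℕ → ℤ
  y r = b ^ (2 ℕ.* d ℕ.∸ suc r)

  Y : ℤ → ℤ
  Y t = t * t - (b + + 1) * t

  z : ℕ → ℤ
  z r = y 0 - y 1 + + 1 + Y (y r)

  x≡1+q : x ≡ + suc q
  x≡1+q = cong (_+_ (+ 1)) (ℤ.neg-involutive (+ q))

  x*gauss : ∀ n → x * gauss q n ≡ + 1 - b ^ n
  x*gauss zero    = ℤ.*-zeroʳ x
  x*gauss (suc n) = begin
    x * (gauss q n + b ^ n)          ≡⟨ ℤ.*-distribˡ-+ x (gauss q n) (b ^ n) ⟩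
    x * gauss q n + x * b ^ n        ≡⟨ cong (_+ x * b ^ n) (x*gauss n) ⟩
    + 1 - b ^ n + (+ 1 - b) * b ^ n  ≡⟨ telescope b (b ^ n) ⟩
    + 1 - b ^ suc n                  ∎
    where
    open ≡-Reasoning
    telescope : ∀ b t → + 1 - t + (+ 1 - b) * t ≡ + 1 - b * t
    telescope = solve-∀

  x*cH : ∀ j → x * cH q d (suc j) ≡ (+ 1 - b ^ suc j) * b ^ j
  x*cH j = begin
    x * (gauss q (suc j) * (+ 1 + (b - + 1) * gauss q j))
      ≡⟨ regroup b (gauss q (suc j)) (gauss q j) ⟩
    x * gauss q (suc j) * (+ 1 - x * gauss q j)
      ≡⟨ cong₂ (λ u v → u * (+ 1 - v)) (x*gauss (suc j)) (x*gauss j) ⟩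
    (+ 1 - b ^ suc j) * (+ 1 - (+ 1 - b ^ j))
      ≡⟨ cong ((+ 1 - b ^ suc j) *_) (cancel (b ^ j)) ⟩
    (+ 1 - b ^ suc j) * b ^ j ∎
    where
    open ≡-Reasoning
    regroup : ∀ b G g → (+ 1 - b) * (G * (+ 1 + (b - + 1) * g)) ≡ (+ 1 - b) * G * (+ 1 - (+ 1 - b) * g)
    regroup = solve-∀
    cancel : ∀ t → + 1 - (+ 1 - t) ≡ t
    cancel = solve-∀

  x*bH : ∀ i → x * bH q d i ≡ b ^ d * b ^ d - b ^ i * b ^ i
  x*bH i = begin
    x * ((gauss q d - gauss q i) * (- b ^ d - + 1 - (b - + 1) * gauss q i))
      ≡⟨ regroup b (b ^ d) (gauss q d) (gauss q i) ⟩
    (x * gauss q d - x * gauss q i) * (- b ^ d - + 1 + x * gauss q i)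
      ≡⟨ cong₂ (λ u v → (u - v) * (- b ^ d - + 1 + v)) (x*gauss d) (x*gauss i) ⟩
    (+ 1 - b ^ d - (+ 1 - b ^ i)) * (- b ^ d - + 1 + (+ 1 - b ^ i))
      ≡⟨ difference-of-squares (b ^ d) (b ^ i) ⟩
    b ^ d * b ^ d - b ^ i * b ^ i ∎
    where
    open ≡-Reasoning
    regroup : ∀ b T G g → (+ 1 - b) * ((G - g) * (- T - + 1 - (b - + 1) * g))
                        ≡ ((+ 1 - b) * G - (+ 1 - b) * g) * (- T - + 1 + (+ 1 - b) * g)
    regroup = solve-∀
    difference-of-squares : ∀ T t → (+ 1 - T - (+ 1 - t)) * (- T - + 1 + (+ 1 - t)) ≡ T * T - t * t
    difference-of-squares = solve-∀

  x*kH : x * kH q d ≡ b ^ d * b ^ d - + 1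
  x*kH = x*bH 0

  x*aH : ∀ i → x * aH q d i ≡ x * kH q d - x * bH q d i - x * cH q d i
  x*aH i = distrib x (kH q d) (bH q d i) (cH q d i)
    where
    distrib : ∀ x k b c → x * (k - b - c) ≡ x * k - x * b - x * c
    distrib = solve-∀

  d≤2d : d ℕ.≤ 2 ℕ.* d
  d≤2d = ℕ.m≤m+n d (d ℕ.+ 0)

  +≤2d : ∀ {m n} → m ℕ.≤ d → n ℕ.≤ d → m ℕ.+ n ℕ.≤ 2 ℕ.* d
  +≤2d m≤d n≤d = ℕ.+-mono-≤ m≤d (subst (_ ℕ.≤_) (sym (ℕ.+-identityʳ d)) n≤d)

  y-shift : ∀ r k → suc r ℕ.+ k ℕ.≤ 2 ℕ.* d → y r ≡ b ^ k * y (r ℕ.+ k)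
  y-shift r k = ^-∸ b k

  y-suc : ∀ r → suc (suc r) ℕ.≤ 2 ℕ.* d → y r ≡ b * y (suc r)
  y-suc r h = trans (y-shift r 1 (subst (ℕ._≤ 2 ℕ.* d) (cong suc (ℕ.+-comm 1 r)) h))
                    (cong₂ _*_ (ℤ.^-identityʳ b) (cong y (ℕ.+-comm r 1)))

  b^d*b^d : 1 ℕ.≤ d → b ^ d * b ^ d ≡ b * y 0
  b^d*b^d 1≤d = begin
    b ^ d * b ^ d          ≡⟨ ℤ.^-distribˡ-+-* b d d ⟨
    b ^ (d ℕ.+ d)          ≡⟨ cong (λ e → b ^ (d ℕ.+ e)) (ℕ.+-identityʳ d) ⟨
    b ^ (2 ℕ.* d ℕ.∸ 0)    ≡⟨ ^-∸ b 1 {0} (+≤2d 1≤d z≤n) ⟩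
    b ^ 1 * y 0            ≡⟨ cong (_* y 0) (ℤ.^-identityʳ b) ⟩
    b * y 0                ∎
    where open ≡-Reasoning

  -- Matching the hypotheses against refl substitutes all the powers of b, which leaves a polynomial
  -- identity in b, s = bʲ and p = y (j + 2).
  step-identity : ∀ {s p C K B T y₀ y₁ yⱼ yⱼ₊₁} →
    C ≡ (+ 1 - b * s) * s → K ≡ T - + 1 → B ≡ T - b * s * (b * s) →
    T ≡ b * y₀ → y₀ ≡ b * y₁ → y₁ ≡ s * yⱼ₊₁ → yⱼ ≡ b * yⱼ₊₁ → yⱼ₊₁ ≡ b * p →
    let ζ = λ t → y₀ - y₁ + + 1 + Y t in
    C * ζ yⱼ + (K - B - C) * ζ yⱼ₊₁ + B * ζ p ≡ (y₁ - + 1) * ζ yⱼ₊₁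
  step-identity {s} {p} refl refl refl refl refl refl refl refl = polynomial b s p
    where
    polynomial : ∀ b s p →
      let y₁ = s * (b * p) ; y₀ = b * y₁ ; T = b * y₀
          ζ = λ t → y₀ - y₁ + + 1 + (t * t - (b + + 1) * t)
          C = (+ 1 - b * s) * s ; B = T - b * s * (b * s)
      in C * ζ (b * (b * p)) + (T - + 1 - B - C) * ζ (b * p) + B * ζ p ≡ (y₁ - + 1) * ζ (b * p)
    polynomial = solve-∀

  z-step : ∀ j → suc j ℕ.< d →
    x * cH q d (suc j) * z j + x * aH q d (suc j) * z (suc j) + x * bH q d (suc j) * z (suc (suc j))
    ≡ (y 1 - + 1) * z (suc j)
  z-step j j<d = trans
    (cong (λ A → x * cH q d (suc j) * z j + A * z (suc j) + x * bH q d (suc j) * z (suc (suc j))) (x*aH (suc j)))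
    (step-identity (x*cH j) x*kH (x*bH (suc j)) (b^d*b^d 1≤d) (y-suc 0 (+≤2d 1≤d 1≤d))
                   (y-shift 1 j (ℕ.≤-trans j<d d≤2d)) (y-suc j (ℕ.≤-trans j<d d≤2d)) (y-suc (suc j) (+≤2d 1≤d j<d)))
    where
    1≤d = ℕ.≤-trans (s≤s z≤n) j<d

  initial-identity : ∀ {K T y₀ y₁} → K ≡ T - + 1 → T ≡ b * y₀ → y₀ ≡ b * y₁ →
    let ζ = λ t → y₀ - y₁ + + 1 + Y t in K * ζ y₁ ≡ (y₁ - + 1) * ζ y₀
  initial-identity {y₁ = v} refl refl refl = polynomial b v
    where
    polynomial : ∀ b v → let ζ = λ t → b * v - v + + 1 + (t * t - (b + + 1) * t) in
      (b * (b * v) - + 1) * ζ v ≡ (v - + 1) * ζ (b * v)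
    polynomial = solve-∀

  z-initial : 1 ℕ.≤ d → x * kH q d * z 1 ≡ (y 1 - + 1) * z 0
  z-initial 1≤d = initial-identity x*kH (b^d*b^d 1≤d) (y-suc 0 (+≤2d 1≤d 1≤d))

  ∣b^n∣ : ∀ n → ∣ b ^ n ∣ ≡ q ℕ.^ n
  ∣b^n∣ n = trans (∣i^n∣≡∣i∣^n b n) (cong (ℕ._^ n) (ℤ.∣-i∣≡∣i∣ (+ q)))

  b^n*b^n : ∀ n → b ^ n * b ^ n ≡ + (q ℕ.^ n ℕ.* q ℕ.^ n)
  b^n*b^n n = trans (i*i≡∣i∣*∣i∣ (b ^ n)) (cong (λ m → + (m ℕ.* m)) (∣b^n∣ n))

  x*bH≢0 : 1 ℕ.< q → ∀ {i} → i ℕ.< d → x * bH q d i ≢ + 0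
  x*bH≢0 1<q {i} i<d x*bH≡0 = ℕ.<-irrefl (ℤ.+-injective squares-equal) squares-increase
    where
    squares-equal : + (q ℕ.^ i ℕ.* q ℕ.^ i) ≡ + (q ℕ.^ d ℕ.* q ℕ.^ d)
    squares-equal = trans (sym (b^n*b^n i))
      (trans (sym (ℤ.i-j≡0⇒i≡j _ _ (trans (sym (x*bH i)) x*bH≡0))) (b^n*b^n d))
    squares-increase : q ℕ.^ i ℕ.* q ℕ.^ i ℕ.< q ℕ.^ d ℕ.* q ℕ.^ d
    squares-increase = ℕ.*-mono-< (ℕ.^-monoʳ-< q 1<q i<d) (ℕ.^-monoʳ-< q 1<q i<d)

module Estimates (c d : ℕ) where
  open import Data.Integer using (_+_; _-_; -_; _*_; _^_; _≤_; ∣_∣)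
  open HermitianFormsGraph (suc c) d

  Y≡ : ∀ t → Y t ≡ t * t + + c * t
  Y≡ t = expand (+ c) t
    where
    expand : ∀ c t → t * t - (- (+ 1 + c) + + 1) * t ≡ t * t + c * t
    expand = solve-∀

  Y-upper : ∀ t → Y t ≤ + (∣ t ∣ ℕ.* ∣ t ∣ ℕ.+ c ℕ.* ∣ t ∣)
  Y-upper t = begin
    Y t                        ≡⟨ Y≡ t ⟩
    t * t + + c * t            ≡⟨ cong (_+ + c * t) (i*i≡∣i∣*∣i∣ t) ⟩
    + (A ℕ.* A) + + c * t      ≤⟨ ℤ.+-monoʳ-≤ (+ (A ℕ.* A)) (ℤ.*-monoˡ-≤-nonNeg (+ c) (i≤∣i∣ t)) ⟩
    + (A ℕ.* A) + + c * + A    ≡⟨ cong (_+_ (+ (A ℕ.* A))) (ℤ.pos-* c A) ⟨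
    + (A ℕ.* A ℕ.+ c ℕ.* A)    ∎
    where
    open ℤ.≤-Reasoning
    A = ∣ t ∣

  Y-lower : ∀ t {H} → c ℕ.+ H ≡ ∣ t ∣ → + (∣ t ∣ ℕ.* H) ≤ Y t
  Y-lower t {H} c+H≡A = begin
    + (A ℕ.* H)                                      ≡⟨ ℤ.pos-* A H ⟩
    + A * + H                                        ≡⟨ cong (_* + H) A≡c+H ⟩
    (+ c + + H) * + H                                ≡⟨ complete-square (+ c) (+ H) ⟩
    (+ c + + H) * (+ c + + H) + + c * - (+ c + + H)  ≡⟨ cong (λ a → a * a + + c * - a) A≡c+H ⟨
    + A * + A + + c * - + A                          ≡⟨ cong (_+ + c * - + A) (i*i≡∣i∣*∣i∣ (+ A)) ⟩
    + (A ℕ.* A) + + c * - + A                        ≤⟨ ℤ.+-monoʳ-≤ (+ (A ℕ.* A)) (ℤ.*-monoˡ-≤-nonNeg (+ c) (-∣i∣≤i t)) ⟩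
    + (A ℕ.* A) + + c * t                            ≡⟨ cong (_+ + c * t) (i*i≡∣i∣*∣i∣ t) ⟨
    t * t + + c * t                                  ≡⟨ Y≡ t ⟨
    Y t                                              ∎
    where
    open ℤ.≤-Reasoning
    A = ∣ t ∣
    A≡c+H : + A ≡ + c + + H
    A≡c+H = cong +_ (sym c+H≡A)
    complete-square : ∀ c h → (c + h) * h ≡ (c + h) * (c + h) + c * - (c + h)
    complete-square = solve-∀

  z₀-pos : 1 ℕ.≤ c → 2 ℕ.≤ d → ℤ.Positive (z 0)
  z₀-pos 1≤c 2≤d = subst ℤ.Positive (sym z₀≡) _
    where
    e = ℕ.pred d
    1≤d = ℕ.≤-trans (s≤s z≤n) 2≤d
    2≤V : 2 ℕ.≤ suc c ℕ.^ e ℕ.* suc c ℕ.^ e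
    2≤V = ℕ.*-mono-≤ (ℕ.≤-trans (s≤s 1≤c) (m≤m^n (suc c) (ℕ.<⇒≤pred 2≤d))) (ℕ.m^n>0 (suc c) e)
    V′ = proj₁ (ℕ.m≤n⇒∃[o]m+o≡n 2≤V)
    2+V′≡V = proj₂ (ℕ.m≤n⇒∃[o]m+o≡n 2≤V)
    K = (2 ℕ.+ V′) ℕ.* (c ℕ.* (c ℕ.+ 2) ℕ.+ suc c ℕ.* suc c ℕ.* V′)
    y₁≡ : y 1 ≡ + (2 ℕ.+ V′)
    y₁≡ = begin
      b ^ (2 ℕ.* d ℕ.∸ 2)               ≡⟨ cong (b ^_) (2*d∸2 d) ⟩
      b ^ (e ℕ.+ e)                     ≡⟨ ℤ.^-distribˡ-+-* b e e ⟩
      b ^ e * b ^ e                     ≡⟨ b^n*b^n e ⟩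
      + (suc c ℕ.^ e ℕ.* suc c ℕ.^ e)   ≡⟨ cong +_ 2+V′≡V ⟨
      + (2 ℕ.+ V′)                      ∎
      where open ≡-Reasoning
    z₀≡ : z 0 ≡ + suc K
    z₀≡ = begin
      y 0 - y 1 + + 1 + Y (y 0)
        ≡⟨ cong (λ u → u - y 1 + + 1 + Y u) (y-suc 0 (+≤2d 1≤d 1≤d)) ⟩
      b * y 1 - y 1 + + 1 + Y (b * y 1)
        ≡⟨ cong (λ v → b * v - v + + 1 + Y (b * v)) y₁≡ ⟩
      b * + (2 ℕ.+ V′) - + (2 ℕ.+ V′) + + 1 + Y (b * + (2 ℕ.+ V′))
        ≡⟨ polynomial (+ c) (+ V′) ⟩
      + 1 + + (2 ℕ.+ V′) * (+ c * + (c ℕ.+ 2) + + suc c * + suc c * + V′)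
        ≡⟨ cong (λ k → + 1 + + (2 ℕ.+ V′) * k) (cong₂ _+_ (sym (ℤ.pos-* c (c ℕ.+ 2)))
             (trans (cong (_* + V′) (sym (ℤ.pos-* (suc c) (suc c)))) (sym (ℤ.pos-* (suc c ℕ.* suc c) V′)))) ⟩
      + 1 + + (2 ℕ.+ V′) * + (c ℕ.* (c ℕ.+ 2) ℕ.+ suc c ℕ.* suc c ℕ.* V′)
        ≡⟨ cong (_+_ (+ 1)) (ℤ.pos-* (2 ℕ.+ V′) (c ℕ.* (c ℕ.+ 2) ℕ.+ suc c ℕ.* suc c ℕ.* V′)) ⟨
      + suc K ∎
      where
      open ≡-Reasoning
      polynomial : ∀ c v → let β = - (+ 1 + c) ; u = + 2 + v ; t = β * u in
        t - u + + 1 + (t * t - (β + + 1) * t) ≡ + 1 + u * (c * (c + + 2) + (+ 1 + c) * (+ 1 + c) * v)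
      polynomial = solve-∀

  z₀-z≡Y-Y : ∀ r → z 0 - z r ≡ Y (y 0) - Y (y r)
  z₀-z≡Y-Y r = cancel (y 0 - y 1 + + 1) (Y (y 0)) (Y (y r))
    where
    cancel : ∀ k u v → k + u - (k + v) ≡ u - v
    cancel = solve-∀

  ∣y∣ : ∀ r → ∣ y r ∣ ≡ suc c ℕ.^ (2 ℕ.* d ℕ.∸ suc r)
  ∣y∣ r = ∣b^n∣ (2 ℕ.* d ℕ.∸ suc r)

  weighted-gaps-≤ : 1 ℕ.≤ c → 2 ℕ.≤ d → ∀ {r} → 1 ℕ.≤ r → r ℕ.≤ d →
    + (r ℕ.* r) * (z 0 - z d) ≤ + (d ℕ.* d) * (z 0 - z r)
  weighted-gaps-≤ 1≤c 2≤d {r} 1≤r r≤d with ℕ.m≤n⇒m<n∨m≡n r≤d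
  ... | inj₂ refl = ℤ.≤-refl
  ... | inj₁ r<d  = subst₂ (λ Δd Δr → + (r ℕ.* r) * Δd ≤ + (d ℕ.* d) * Δr) (sym (z₀-z≡Y-Y d)) (sym (z₀-z≡Y-Y r))
    (weighted-difference-≤ (ℕ.<⇒≤ r<d) L≤Y₀ (Y-upper (y r)) 0≤Y[yd]
      (gap-estimate r<d (n<m^n r 1<q) (m≤m^n q 1≤r) 2≤A c+H≡PA))
    where
    q = suc c
    1<q : 1 ℕ.< q
    1<q = s≤s 1≤c
    1≤d = ℕ.≤-trans (s≤s z≤n) 2≤d
    c<∣y∣ : ∀ {m} → suc (suc m) ℕ.≤ 2 ℕ.* d → c ℕ.< ∣ y m ∣
    c<∣y∣ m<2d = subst (q ℕ.≤_) (sym (∣y∣ _)) (m≤m^n q (ℕ.m<n⇒0<n∸m m<2d))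
    A = ∣ y r ∣
    P = q ℕ.^ r
    2≤A : 2 ℕ.≤ A
    2≤A = ℕ.≤-trans 1<q (c<∣y∣ (+≤2d 1≤d r<d))
    ∣y₀∣≡PA : ∣ y 0 ∣ ≡ P ℕ.* A
    ∣y₀∣≡PA = trans (cong ∣_∣ (y-shift 0 r (ℕ.≤-trans r<d d≤2d)))
                    (trans (ℤ.abs-* (b ^ r) (y r)) (cong (ℕ._* A) (∣b^n∣ r)))
    H = proj₁ (ℕ.m≤n⇒∃[o]m+o≡n (ℕ.<⇒≤ (c<∣y∣ {0} (+≤2d 1≤d 1≤d))))
    c+H≡∣y₀∣ : c ℕ.+ H ≡ ∣ y 0 ∣
    c+H≡∣y₀∣ = proj₂ (ℕ.m≤n⇒∃[o]m+o≡n (ℕ.<⇒≤ (c<∣y∣ {0} (+≤2d 1≤d 1≤d))))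
    c+H≡PA : c ℕ.+ H ≡ P ℕ.* A
    c+H≡PA = trans c+H≡∣y₀∣ ∣y₀∣≡PA
    L≤Y₀ : + (P ℕ.* A ℕ.* H) ≤ Y (y 0)
    L≤Y₀ = subst (λ m → + (m ℕ.* H) ≤ Y (y 0)) ∣y₀∣≡PA (Y-lower (y 0) c+H≡∣y₀∣)
    0≤Y[yd] : + 0 ≤ Y (y d)
    0≤Y[yd] = let H′ , c+H′≡∣yd∣ = ℕ.m≤n⇒∃[o]m+o≡n (ℕ.<⇒≤ (c<∣y∣ {d} (+≤2d 2≤d ℕ.≤-refl)))
            in ℤ.≤-trans (ℤ.+≤+ z≤n) (Y-lower (y d) c+H′≡∣yd∣)

module CosineSequence (c d : ℕ) (1≤c : 1 ℕ.≤ c) (2≤d : 2 ℕ.≤ d) (w : ℕ → ℚ)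
                      (cos : IsCosineSeq (suc c) d (θH (suc c) d 2) w) where
  open import Data.Rational using (_-_; _*_; _≤_)
  open HermitianFormsGraph (suc c) d
  open Estimates c d
  open IsCosineSeq cos

  N : ℚ
  N = ⟦ z 0 ⟧

  ⟦x⟧*θ : ∀ i → ⟦ x ⟧ * θH (suc c) d i ≡ ⟦ b ℤ.^ (2 ℕ.* d ℕ.∸ i) ℤ.- + 1 ⟧
  ⟦x⟧*θ i = trans (cong (λ t → ⟦ t ⟧ * θH (suc c) d i) x≡1+q)
                  (⟦⟧-*-/ (suc (suc c)) (b ℤ.^ (2 ℕ.* d ℕ.∸ i) ℤ.- + 1))

  ⟦x*bH⟧≢0 : ∀ {i} → i ℕ.< d → ⟦ x ℤ.* bH (suc c) d i ⟧ ≢ 0ℚ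
  ⟦x*bH⟧≢0 i<d eq = x*bH≢0 (s≤s 1≤c) i<d (⟦⟧-injective {j = + 0} eq)

  xc xa xb : ℕ → ℚ
  xc i = ⟦ x ℤ.* cH (suc c) d i ⟧
  xa i = ⟦ x ℤ.* aH (suc c) d i ⟧
  xb i = ⟦ x ℤ.* bH (suc c) d i ⟧

  xθ : ℚ
  xθ = ⟦ y 1 ℤ.- + 1 ⟧

  N*w-recurrence : ThreeTermRecurrence xc xa xb xθ d (λ r → N * w r)
  N*w-recurrence = ThreeTermRecurrence-scale ⟦ x ⟧ N
    (λ i → ⟦⟧-homo-* x (cH (suc c) d i)) (λ i → ⟦⟧-homo-* x (aH (suc c) d i)) (λ i → ⟦⟧-homo-* x (bH (suc c) d i))
    (sym (⟦x⟧*θ 2)) rec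

  z-recurrence : ThreeTermRecurrence xc xa xb xθ d (λ r → ⟦ z r ⟧)
  z-recurrence j j<d = trans
    (sym (⟦⟧-homo-Σ₃ (x ℤ.* cH (suc c) d (suc j)) (z j) (x ℤ.* aH (suc c) d (suc j)) (z (suc j))
                     (x ℤ.* bH (suc c) d (suc j)) (z (suc (suc j)))))
    (trans (cong ⟦_⟧ (z-step j j<d)) (⟦⟧-homo-* (y 1 ℤ.- + 1) (z (suc j))))

  N*w₁≡z₁ : N * w 1 ≡ ⟦ z 1 ⟧
  N*w₁≡z₁ = *-cancelˡ-≢0 ⟦ x ℤ.* k ⟧ (⟦x*bH⟧≢0 {0} 0<d) (begin
    ⟦ x ℤ.* k ⟧ * (N * w 1)      ≡⟨ cong (_* (N * w 1)) (⟦⟧-homo-* x k) ⟩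
    ⟦ x ⟧ * ⟦ k ⟧ * (N * w 1)    ≡⟨ shuffle ⟦ x ⟧ ⟦ k ⟧ N (w 1) ⟩
    N * (⟦ x ⟧ * (⟦ k ⟧ * w 1))  ≡⟨ cong (λ t → N * (⟦ x ⟧ * t)) w₁ ⟩
    N * (⟦ x ⟧ * θH (suc c) d 2) ≡⟨ cong (N *_) (⟦x⟧*θ 2) ⟩
    N * ⟦ y 1 ℤ.- + 1 ⟧          ≡⟨ ℚ.*-comm N ⟦ y 1 ℤ.- + 1 ⟧ ⟩
    ⟦ y 1 ℤ.- + 1 ⟧ * N          ≡⟨ ⟦⟧-homo-* (y 1 ℤ.- + 1) (z 0) ⟨
    ⟦ (y 1 ℤ.- + 1) ℤ.* z 0 ⟧    ≡⟨ cong ⟦_⟧ (z-initial 0<d) ⟨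
    ⟦ x ℤ.* k ℤ.* z 1 ⟧          ≡⟨ ⟦⟧-homo-* (x ℤ.* k) (z 1) ⟩
    ⟦ x ℤ.* k ⟧ * ⟦ z 1 ⟧        ∎)
    where
    open ≡-Reasoning
    k = kH (suc c) d
    0<d = ℕ.≤-trans (s≤s z≤n) 2≤d
    shuffle : ∀ x k n w → x * k * (n * w) ≡ n * (x * (k * w))
    shuffle = solve 4 (λ x k n w → x :* k :* (n :* w) := n :* (x :* (k :* w))) refl

  N*w≡z : ∀ r → r ℕ.≤ d → N * w r ≡ ⟦ z r ⟧
  N*w≡z = ThreeTermRecurrence-unique {xc} {xa} {xb} {xθ} {d} (λ j j<d → ⟦x*bH⟧≢0 j<d)
    N*w-recurrence z-recurrence (trans (cong (N *_) w₀) (ℚ.*-identityʳ N)) N*w₁≡z₁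

  N*[1-w]≡z₀-z : ∀ r → r ℕ.≤ d → N * (1ℚ - w r) ≡ ⟦ z 0 ℤ.- z r ⟧
  N*[1-w]≡z₀-z r r≤d = begin
    N * (1ℚ - w r)       ≡⟨ distrib N (w r) ⟩
    N - N * w r          ≡⟨ cong (_-_ N) (N*w≡z r r≤d) ⟩
    ⟦ z 0 ⟧ - ⟦ z r ⟧    ≡⟨ ⟦⟧-homo-− (z 0) (z r) ⟨
    ⟦ z 0 ℤ.- z r ⟧      ∎
    where
    open ≡-Reasoning
    distrib : ∀ n w → n * (1ℚ - w) ≡ n - n * w
    distrib = solve 2 (λ n w → n :* (con 1ℚ :- w) := n :- n :* w) refl

  minimum-at-d : ∀ r → 1 ℕ.≤ r → r ℕ.≤ d → (1ℚ - w d) * invSq d ≤ (1ℚ - w r) * invSq r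
  minimum-at-d r 1≤r r≤d =
    invSq-cross-≤ N {{⟦⟧-pos (z 0) {{z₀-pos 1≤c 2≤d}}}} (1ℚ - w d) (1ℚ - w r) 1≤r (ℕ.≤-trans 1≤r r≤d) (begin
      ⟦ + (r ℕ.* r) ⟧ * (N * (1ℚ - w d))   ≡⟨ cong (⟦ + (r ℕ.* r) ⟧ *_) (N*[1-w]≡z₀-z d ℕ.≤-refl) ⟩
      ⟦ + (r ℕ.* r) ⟧ * ⟦ z 0 ℤ.- z d ⟧    ≡⟨ ⟦⟧-homo-* (+ (r ℕ.* r)) (z 0 ℤ.- z d) ⟨
      ⟦ + (r ℕ.* r) ℤ.* (z 0 ℤ.- z d) ⟧    ≤⟨ ⟦⟧-mono-≤ (weighted-gaps-≤ 1≤c 2≤d 1≤r r≤d) ⟩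
      ⟦ + (d ℕ.* d) ℤ.* (z 0 ℤ.- z r) ⟧    ≡⟨ ⟦⟧-homo-* (+ (d ℕ.* d)) (z 0 ℤ.- z r) ⟩
      ⟦ + (d ℕ.* d) ⟧ * ⟦ z 0 ℤ.- z r ⟧    ≡⟨ cong (⟦ + (d ℕ.* d) ⟧ *_) (N*[1-w]≡z₀-z r r≤d) ⟨
      ⟦ + (d ℕ.* d) ⟧ * (N * (1ℚ - w r))   ∎)
    where open ℚ.≤-Reasoning

open import Data.Nat using (_≤_)
open import Data.Rational using (_-_; _*_)

proposition5p3 : (q d : ℕ) → IsPrimePower q → 2 ≤ d →
    (w : ℕ → ℚ) → IsCosineSeq q d (θH q d 2) w →
    minFrom1 (λ r → (1ℚ - w r) * invSq r) d ≡ (1ℚ - w d) * invSq d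
proposition5p3 q d@(suc d′) q-prime-power 2≤d w cos with prime-power>1 q-prime-power
... | s≤s {n = c} 1≤c = minFrom1-attained (λ r → (1ℚ - w r) * invSq r) d′
  (CosineSequence.minimum-at-d c d 1≤c 2≤d w cos)
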